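{- Let $C$ be a field, $E$ a vector space over $C$ with a valuation $v:E\to\Gamma_\infty$, and let $(f,\gamma)\mapsto f|_\gamma:E\times\Gamma\to E$ satisfy (t1)–(t4) below. Then for all $f,g\in E$ and $\alpha,\beta\in\Gamma$: (i) $\operatorname{sp}(f|_\alpha)=\operatorname{sp}(f)^{<\alpha}$; (ii) $\operatorname{sp}(f+g)\subseteq\operatorname{sp}(f)\cup\operatorname{sp}(g)$, and $\operatorname{sp}(cf)=\operatorname{sp}(f)$ for $c\in C^\times$; (iii) $\operatorname{sp}(f-f|_\alpha)=\operatorname{sp}(f)^{\ge\alpha}$; (iv) if $v(f-f|_\alpha)=\beta$, then $\beta\in\operatorname{sp}(f)$; (v) if $\alpha>\operatorname{sp}(f)$ (i.e. $\alpha>\delta$ for all $\delta\in\operatorname{sp}(f)$), then $f|_\alpha=f$, and otherwise $f|_\alpha=f|_\beta$ for a unique $\beta\in\operatorname{sp}(f)$, and $\alpha\le\beta$ for this $\beta$.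
   Context: $\Gamma$ is a linearly ordered set, $\Gamma_\infty=\Gamma\cup\{\infty\}$ with $\gamma<\infty$ for all $\gamma\in\Gamma$. A valuation on the $C$-vector space $E$ is a surjective map $v:E\to\Gamma_\infty$ with $v(f)=\infty\iff f=0$, $v(cf)=v(f)$ for $c\in C^\times$, and $v(f+g)\ge\min(vf,vg)$. The truncation map satisfies, for all $f,g\in E$, $c\in C$, $\alpha,\beta\in\Gamma$: (t1) $v(f-f|_\alpha)\ge\alpha$; (t2) $v(f)\ge\alpha\Rightarrow f|_\alpha=0$; (t3) $\beta>\alpha\Rightarrow(f|_\alpha)|_\beta=f|_\alpha$; (t4) $(f+g)|_\alpha=f|_\alpha+g|_\alpha$ and $(cf)|_\alpha=c(f|_\alpha)$. Set $\operatorname{sp}(f)=\{\gamma\in\Gamma: v(f-f|_\gamma)=\gamma\}$; for $S\subseteq\Gamma$, $S^{<\alpha}=\{\delta\in S:\delta<\alpha\}$ and $S^{\ge\alpha}=\{\delta\in S:\delta\ge\alpha\}$. -}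

module Defs where

open import Level using (Level; _⊔_)
open import Data.Product using (Σ; ∃; _×_; _,_)
open import Data.Sum using (_⊎_)
open import Data.Empty using (⊥)
open import Relation.Nullary using (¬_)
open import Relation.Binary.Core using (Rel)
open import Relation.Binary.Structures using (IsStrictTotalOrder)
open import Relation.Binary.Definitions using (tri<; tri≈; tri>)
open import Relation.Binary.PropositionalEquality using (_≡_)
open import Algebra.Bundles using (CommutativeRing)
open import Algebra.Module.Bundles using (Module)

record IsField {c ℓ : Level} (R : CommutativeRing c ℓ) : Set (c ⊔ ℓ) where
  open CommutativeRing R
  field
    0≉1     : ¬ (0# ≈ 1#)
    inverse : ∀ x → ¬ (x ≈ 0#) → ∃ λ y → (x * y) ≈ 1#

data Γ∞ {g : Level} (Γ : Set g) : Set g where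
  fin : Γ → Γ∞ Γ
  ∞   : Γ∞ Γ

module Setup {c ℓ m ℓm g ℓg : Level}
  (C : CommutativeRing c ℓ) (E : Module C m ℓm)
  (Γ : Set g) (_<_ : Rel Γ ℓg) (sto : IsStrictTotalOrder _≡_ _<_) where

  open CommutativeRing C using (Carrier; _≈_; 0#)
  open Module E using (Carrierᴹ; _≈ᴹ_; _+ᴹ_; -ᴹ_; _*ₗ_; 0ᴹ)
  open IsStrictTotalOrder sto using (compare)

  _−ᴹ_ : Carrierᴹ → Carrierᴹ → Carrierᴹ
  f −ᴹ h = f +ᴹ (-ᴹ h)

  _≤_ : Γ → Γ → Set (g ⊔ ℓg)
  α ≤ β = (α < β) ⊎ (α ≡ β)

  data _≤∞_ : Γ∞ Γ → Γ∞ Γ → Set (g ⊔ ℓg) where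
    fin≤fin : ∀ {α β} → α ≤ β → fin α ≤∞ fin β
    _≤∞∞    : ∀ x → x ≤∞ ∞

  min∞ : Γ∞ Γ → Γ∞ Γ → Γ∞ Γ
  min∞ ∞ y = y
  min∞ (fin α) ∞ = fin α
  min∞ (fin α) (fin β) with compare α β
  ... | tri< _ _ _ = fin α
  ... | tri≈ _ _ _ = fin α
  ... | tri> _ _ _ = fin β

  record IsValuation (v : Carrierᴹ → Γ∞ Γ) : Set (c ⊔ ℓ ⊔ m ⊔ ℓm ⊔ g ⊔ ℓg) where
    field
      v-cong     : ∀ {f h} → f ≈ᴹ h → v f ≡ v h
      surjective : ∀ (x : Γ∞ Γ) → ∃ λ f → v f ≡ x
      v-∞⇒0      : ∀ f → v f ≡ ∞ → f ≈ᴹ 0ᴹ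
      0⇒v-∞      : ∀ f → f ≈ᴹ 0ᴹ → v f ≡ ∞
      v-scale    : ∀ (a : Carrier) f → ¬ (a ≈ 0#) → v (a *ₗ f) ≡ v f
      v-ultra    : ∀ f h → min∞ (v f) (v h) ≤∞ v (f +ᴹ h)

  -- truncation map (f , γ) ↦ f|_γ, written tr f γ, satisfying (t1)–(t4)
  -- (tr must respect the setoid equality of E)
  record IsTruncation (v : Carrierᴹ → Γ∞ Γ) (tr : Carrierᴹ → Γ → Carrierᴹ)
         : Set (c ⊔ ℓ ⊔ m ⊔ ℓm ⊔ g ⊔ ℓg) where
    field
      tr-cong : ∀ {f h} α → f ≈ᴹ h → tr f α ≈ᴹ tr h α
      t1      : ∀ f α → fin α ≤∞ v (f −ᴹ tr f α)
      t2      : ∀ f α → fin α ≤∞ v f → tr f α ≈ᴹ 0ᴹ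
      t3      : ∀ f α β → α < β → tr (tr f α) β ≈ᴹ tr f α
      t4+     : ∀ f h α → tr (f +ᴹ h) α ≈ᴹ (tr f α +ᴹ tr h α)
      t4*     : ∀ (a : Carrier) f α → tr (a *ₗ f) α ≈ᴹ (a *ₗ tr f α)

  sp : (Carrierᴹ → Γ∞ Γ) → (Carrierᴹ → Γ → Carrierᴹ) → Carrierᴹ → Γ → Set g
  sp v tr f γ = v (f −ᴹ tr f γ) ≡ fin γ

{-# OPTIONS --safe #-}
module Submission where

open import Defs
open import Level using (Level; _⊔_)
open import Data.Product using (Σ; _×_; _,_)
open import Data.Sum using (_⊎_; inj₁; inj₂)
open import Data.Empty using (⊥-elim)
open import Relation.Nullary using (¬_)
open import Relation.Binary.Core using (Rel)
open import Relation.Binary.Structures using (IsStrictTotalOrder)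
open import Relation.Binary.Definitions using (tri<; tri≈; tri>)
open import Relation.Binary.PropositionalEquality using (_≡_; _≢_; refl; sym; trans; subst)
import Relation.Binary.Construct.StrictToNonStrict as StrictToNonStrict
open import Algebra.Bundles using (CommutativeRing; AbelianGroup)
open import Algebra.Module.Bundles using (Module)
open import Function.Bundles using (_⇔_; mk⇔; Equivalence)

-- Truncation at α is linear, satisfies (f|α)|β = f|min(α,β), and f|β = g|β
-- as soon as v(f − g) ≥ β.  Together with the strict ultrametric inequality
-- (v(x + y) = v x whenever v y > v x) this compares each of sp(f|α),
-- sp(f − f|α), sp(f + g) and sp(cf) with sp(f): in each case the relevant
-- tail h − h|γ is a sum of tails of f whose valuations are known.  For (v),
-- either v(f − f|α) = ∞, so f|α = f, or v(f − f|α) = β ≥ α, and then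
-- β ∈ sp(f) with f|β = f|α.

module SubtractionLaws {a ℓ} (G : AbelianGroup a ℓ) where
  open AbelianGroup G
  open import Algebra.Properties.AbelianGroup G
    using (//-rightDividesˡ; ⁻¹-anti-homo‿-; ⁻¹-∙-comm)
  open import Algebra.Properties.CommutativeSemigroup commutativeSemigroup using (interchange)
  open import Relation.Binary.Reasoning.Setoid setoid

  [x-y]∙[y-z]≈x-z : ∀ x y z → (x - y) ∙ (y - z) ≈ x - z
  [x-y]∙[y-z]≈x-z x y z = begin
    (x - y) ∙ (y - z)  ≈⟨ assoc (x - y) y (z ⁻¹) ⟨
    (x - y) ∙ y - z    ≈⟨ ∙-congʳ (//-rightDividesˡ y x) ⟩
    x - z              ∎

  [x-y]-[z-y]≈x-z : ∀ x y z → (x - y) - (z - y) ≈ x - z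
  [x-y]-[z-y]≈x-z x y z = begin
    (x - y) - (z - y)  ≈⟨ ∙-congˡ (⁻¹-anti-homo‿- z y) ⟩
    (x - y) ∙ (y - z)  ≈⟨ [x-y]∙[y-z]≈x-z x y z ⟩
    x - z              ∎

  [x∙y]-[u∙w]≈[x-u]∙[y-w] : ∀ x y u w → (x ∙ y) - (u ∙ w) ≈ (x - u) ∙ (y - w)
  [x∙y]-[u∙w]≈[x-u]∙[y-w] x y u w = begin
    (x ∙ y) - (u ∙ w)        ≈⟨ ∙-congˡ (⁻¹-∙-comm u w) ⟨
    (x ∙ y) ∙ (u ⁻¹ ∙ w ⁻¹)  ≈⟨ interchange x y (u ⁻¹) (w ⁻¹) ⟩
    (x - u) ∙ (y - w)        ∎

module ScalarNegation {r ℓr m ℓm} {R : CommutativeRing r ℓr} (M : Module R m ℓm) where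
  open CommutativeRing R using (0#; 1#; _+_; -_; -‿inverseʳ)
  open Module M
  open import Algebra.Properties.AbelianGroup +ᴹ-abelianGroup using (inverseʳ-unique)
  open import Relation.Binary.Reasoning.Setoid ≈ᴹ-setoid

  -1#*ₗx≈-ᴹx : ∀ x → (- 1#) *ₗ x ≈ᴹ -ᴹ x
  -1#*ₗx≈-ᴹx x = inverseʳ-unique x ((- 1#) *ₗ x) (begin
    x +ᴹ (- 1#) *ₗ x          ≈⟨ +ᴹ-congʳ (*ₗ-identityˡ x) ⟨
    1# *ₗ x +ᴹ (- 1#) *ₗ x    ≈⟨ *ₗ-distribʳ x 1# (- 1#) ⟨
    (1# + - 1#) *ₗ x          ≈⟨ *ₗ-congʳ (-‿inverseʳ 1#) ⟩
    0# *ₗ x                   ≈⟨ *ₗ-zeroˡ x ⟩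
    0ᴹ                        ∎)

  -ᴹ‿distribʳ-*ₗ : ∀ a x → -ᴹ (a *ₗ x) ≈ᴹ a *ₗ (-ᴹ x)
  -ᴹ‿distribʳ-*ₗ a x = ≈ᴹ-sym (inverseʳ-unique (a *ₗ x) (a *ₗ (-ᴹ x)) (begin
    a *ₗ x +ᴹ a *ₗ (-ᴹ x)  ≈⟨ *ₗ-distribˡ a x (-ᴹ x) ⟨
    a *ₗ (x +ᴹ -ᴹ x)       ≈⟨ *ₗ-congˡ (-ᴹ‿inverseʳ x) ⟩
    a *ₗ 0ᴹ                ≈⟨ *ₗ-zeroʳ a ⟩
    0ᴹ                     ∎))

module ValuedSpace {c ℓ m ℓm g ℓg : Level}
  (C : CommutativeRing c ℓ) (E : Module C m ℓm)
  (Γ : Set g) (_<_ : Rel Γ ℓg) (sto : IsStrictTotalOrder _≡_ _<_) where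

  open CommutativeRing C using (Carrier; _≈_; 0#; 1#; -_)
  module R = CommutativeRing C
  open Module E
  open Setup C E Γ _<_ sto
  open IsStrictTotalOrder sto using (compare; irrefl; isEquivalence; <-resp-≈; <-respʳ-≈)
    renaming (trans to <-trans)
  open import Algebra.Properties.AbelianGroup +ᴹ-abelianGroup
    using (//-cong₂; //-rightDividesʳ; x∙y⁻¹≈ε⇒x≈y; x≈y⇒x∙y⁻¹≈ε; inverseʳ-unique; loop)
  open import Algebra.Properties.Loop loop using (x//ε≈x)
  open SubtractionLaws +ᴹ-abelianGroup
  open ScalarNegation E
  open import Relation.Binary.Reasoning.Setoid ≈ᴹ-setoid

  private
    variable
      α β γ : Γ
      x y z : Γ∞ Γ

  ≤-trans : α ≤ β → β ≤ γ → α ≤ γ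
  ≤-trans = StrictToNonStrict.trans _≡_ _<_ isEquivalence <-resp-≈ <-trans

  <-≤-trans : α < β → β ≤ γ → α < γ
  <-≤-trans = StrictToNonStrict.<-≤-trans _≡_ _<_ <-trans <-respʳ-≈

  ≤⇒≯ : α ≤ β → ¬ β < α
  ≤⇒≯ α≤β β<α = irrefl refl (<-≤-trans β<α α≤β)

  <⊎≥ : ∀ α β → α < β ⊎ β ≤ α
  <⊎≥ α β with compare α β
  ... | tri< α<β _ _ = inj₁ α<β
  ... | tri≈ _ refl _ = inj₂ (inj₂ refl)
  ... | tri> _ _ β<α = inj₂ (inj₁ β<α)

  data _<∞_ : Γ∞ Γ → Γ∞ Γ → Set (g ⊔ ℓg) where
    fin<fin : α < β → fin α <∞ fin β
    fin<∞   : fin α <∞ ∞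

  fin-injective : fin α ≡ fin β → α ≡ β
  fin-injective refl = refl

  ≤∞-reflexive : x ≡ y → x ≤∞ y
  ≤∞-reflexive {fin α} refl = fin≤fin (inj₂ refl)
  ≤∞-reflexive {∞}     refl = ∞ ≤∞∞

  ≤∞-trans : x ≤∞ y → y ≤∞ z → x ≤∞ z
  ≤∞-trans (fin≤fin α≤β) (fin≤fin β≤γ) = fin≤fin (≤-trans α≤β β≤γ)
  ≤∞-trans x≤y           (_ ≤∞∞)       = _ ≤∞∞

  <∞-≤∞-trans : x <∞ y → y ≤∞ z → x <∞ z
  <∞-≤∞-trans (fin<fin α<β) (fin≤fin β≤γ) = fin<fin (<-≤-trans α<β β≤γ)
  <∞-≤∞-trans (fin<fin _)   (_ ≤∞∞)       = fin<∞
  <∞-≤∞-trans fin<∞         (_ ≤∞∞)       = fin<∞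

  <∞⇒≤∞ : x <∞ y → x ≤∞ y
  <∞⇒≤∞ (fin<fin α<β) = fin≤fin (inj₁ α<β)
  <∞⇒≤∞ fin<∞         = _ ≤∞∞

  <∞⇒≢ : x <∞ y → x ≢ y
  <∞⇒≢ (fin<fin α<α) refl = irrefl refl α<α

  ≤∞⇒<∞⊎≡ : x ≤∞ y → x <∞ y ⊎ x ≡ y
  ≤∞⇒<∞⊎≡ (fin≤fin (inj₁ α<β)) = inj₁ (fin<fin α<β)
  ≤∞⇒<∞⊎≡ (fin≤fin (inj₂ refl)) = inj₂ refl
  ≤∞⇒<∞⊎≡ (fin α ≤∞∞)          = inj₁ fin<∞
  ≤∞⇒<∞⊎≡ (∞ ≤∞∞)              = inj₂ refl

  min∞-sel : ∀ x y → min∞ x y ≡ x ⊎ min∞ x y ≡ y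
  min∞-sel ∞       y       = inj₂ refl
  min∞-sel (fin α) ∞       = inj₁ refl
  min∞-sel (fin α) (fin β) with compare α β
  ... | tri< _ _ _ = inj₁ refl
  ... | tri≈ _ _ _ = inj₁ refl
  ... | tri> _ _ _ = inj₂ refl

  -- The only use of the field hypothesis: v(−x) = v x needs −1 ≉ 0.
  module Valuation (0≉1 : ¬ 0# ≈ 1#) (v : Carrierᴹ → Γ∞ Γ) (isV : IsValuation v) where
    open IsValuation isV

    v-‿-ᴹ : ∀ f → v (-ᴹ f) ≡ v f
    v-‿-ᴹ f = trans (v-cong (≈ᴹ-sym (-1#*ₗx≈-ᴹx f))) (v-scale (- 1#) f -1≉0)
      where
      open import Algebra.Properties.Ring R.ring using (-0#≈0#; -‿involutive)
      -1≉0 : ¬ (- 1#) ≈ 0#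
      -1≉0 -1≈0 = 0≉1 (R.sym (R.trans (R.sym (-‿involutive 1#))
                                       (R.trans (R.-‿cong -1≈0) -0#≈0#)))

    v-+-upward : ∀ {p} (P : Γ∞ Γ → Set p) → (∀ {x y} → P x → x ≤∞ y → P y) →
                 ∀ f h → P (v f) → P (v h) → P (v (f +ᴹ h))
    v-+-upward P upward f h Pvf Pvh with min∞-sel (v f) (v h)
    ... | inj₁ min≡vf = upward (subst P (sym min≡vf) Pvf) (v-ultra f h)
    ... | inj₂ min≡vh = upward (subst P (sym min≡vh) Pvh) (v-ultra f h)

    v-+-dominant : ∀ f h → fin γ <∞ v h → v f ≡ fin γ → v (f +ᴹ h) ≡ fin γ
    v-+-dominant {γ} f h γ<vh vf≡γ
      with ≤∞⇒<∞⊎≡ (v-+-upward (fin γ ≤∞_) ≤∞-trans f h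
                      (≤∞-reflexive (sym vf≡γ)) (<∞⇒≤∞ γ<vh))
    ... | inj₂ γ≡v[f+h] = sym γ≡v[f+h]
    ... | inj₁ γ<v[f+h] = ⊥-elim (<∞⇒≢ γ<vf (sym vf≡γ))
      where
      γ<vf : fin γ <∞ v f
      γ<vf = subst (fin γ <∞_) (v-cong (//-rightDividesʳ h f))
                   (v-+-upward (fin γ <∞_) <∞-≤∞-trans (f +ᴹ h) (-ᴹ h) γ<v[f+h]
                     (subst (fin γ <∞_) (sym (v-‿-ᴹ h)) γ<vh))

    v-+-strict : ∀ f h → fin γ <∞ v h → v f ≡ fin γ ⇔ v (f +ᴹ h) ≡ fin γ
    v-+-strict {γ} f h γ<vh = mk⇔ (v-+-dominant f h γ<vh) (λ v[f+h]≡γ →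
      trans (sym (v-cong (//-rightDividesʳ h f))) (v-+-dominant (f +ᴹ h) (-ᴹ h)
        (subst (fin γ <∞_) (sym (v-‿-ᴹ h)) γ<vh) v[f+h]≡γ))

    module Truncation (tr : Carrierᴹ → Γ → Carrierᴹ) (isT : IsTruncation v tr) where
      open IsTruncation isT

      tail : Carrierᴹ → Γ → Carrierᴹ
      tail f α = f −ᴹ tr f α

      tr-0ᴹ : ∀ α → tr 0ᴹ α ≈ᴹ 0ᴹ
      tr-0ᴹ α = t2 0ᴹ α (subst (fin α ≤∞_) (sym (0⇒v-∞ 0ᴹ ≈ᴹ-refl)) (fin α ≤∞∞))

      tr-‿-ᴹ : ∀ f α → tr (-ᴹ f) α ≈ᴹ -ᴹ tr f α
      tr-‿-ᴹ f α = inverseʳ-unique (tr f α) (tr (-ᴹ f) α) (begin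
        tr f α +ᴹ tr (-ᴹ f) α  ≈⟨ t4+ f (-ᴹ f) α ⟨
        tr (f +ᴹ -ᴹ f) α       ≈⟨ tr-cong α (-ᴹ‿inverseʳ f) ⟩
        tr 0ᴹ α                ≈⟨ tr-0ᴹ α ⟩
        0ᴹ                     ∎)

      tr-−ᴹ : ∀ f h α → tr (f −ᴹ h) α ≈ᴹ tr f α −ᴹ tr h α
      tr-−ᴹ f h α = ≈ᴹ-trans (t4+ f (-ᴹ h) α) (+ᴹ-congˡ (tr-‿-ᴹ h α))

      tail-+ᴹ : ∀ f h γ → tail (f +ᴹ h) γ ≈ᴹ tail f γ +ᴹ tail h γ
      tail-+ᴹ f h γ = begin
        (f +ᴹ h) −ᴹ tr (f +ᴹ h) γ          ≈⟨ //-cong₂ ≈ᴹ-refl (t4+ f h γ) ⟩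
        (f +ᴹ h) −ᴹ (tr f γ +ᴹ tr h γ)     ≈⟨ [x∙y]-[u∙w]≈[x-u]∙[y-w] f h (tr f γ) (tr h γ) ⟩
        tail f γ +ᴹ tail h γ               ∎

      tail-*ₗ : ∀ (a : Carrier) f γ → tail (a *ₗ f) γ ≈ᴹ a *ₗ tail f γ
      tail-*ₗ a f γ = begin
        (a *ₗ f) −ᴹ tr (a *ₗ f) γ   ≈⟨ //-cong₂ ≈ᴹ-refl (t4* a f γ) ⟩
        (a *ₗ f) −ᴹ (a *ₗ tr f γ)   ≈⟨ +ᴹ-congˡ (-ᴹ‿distribʳ-*ₗ a (tr f γ)) ⟩
        a *ₗ f +ᴹ a *ₗ (-ᴹ tr f γ)  ≈⟨ *ₗ-distribˡ a f (-ᴹ tr f γ) ⟨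
        a *ₗ tail f γ               ∎

      tr-cong-≤v : ∀ f h β → fin β ≤∞ v (f −ᴹ h) → tr f β ≈ᴹ tr h β
      tr-cong-≤v f h β β≤v[f-h] = x∙y⁻¹≈ε⇒x≈y (tr f β) (tr h β) (begin
        tr f β −ᴹ tr h β  ≈⟨ tr-−ᴹ f h β ⟨
        tr (f −ᴹ h) β     ≈⟨ t2 (f −ᴹ h) β β≤v[f-h] ⟩
        0ᴹ                ∎)

      tr-tr-≤ : ∀ f → β ≤ α → tr (tr f α) β ≈ᴹ tr f β
      tr-tr-≤ {β} {α} f β≤α =
        ≈ᴹ-sym (tr-cong-≤v f (tr f α) β (≤∞-trans (fin≤fin β≤α) (t1 f α)))

      tr-tr-≥ : ∀ f → α ≤ β → tr (tr f α) β ≈ᴹ tr f α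
      tr-tr-≥ f (inj₁ α<β) = t3 f _ _ α<β
      tr-tr-≥ f (inj₂ refl) = tr-tr-≤ f (inj₂ refl)

      v-tail≡fin⇒≤ : ∀ f → v (tail f α) ≡ fin β → α ≤ β
      v-tail≡fin⇒≤ {α} f v-tail≡β with subst (fin α ≤∞_) v-tail≡β (t1 f α)
      ... | fin≤fin α≤β = α≤β

      v-tail≡fin⇒tr≈ : ∀ f → v (tail f α) ≡ fin β → tr f β ≈ᴹ tr f α
      v-tail≡fin⇒tr≈ {α} {β} f v-tail≡β = begin
        tr f β          ≈⟨ tr-cong-≤v f (tr f α) β (≤∞-reflexive (sym v-tail≡β)) ⟩
        tr (tr f α) β   ≈⟨ tr-tr-≥ f (v-tail≡fin⇒≤ f v-tail≡β) ⟩
        tr f α          ∎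

      sp-v-tail : ∀ f α β → v (tail f α) ≡ fin β → sp v tr f β
      sp-v-tail f α β v-tail≡β =
        trans (v-cong (//-cong₂ ≈ᴹ-refl (v-tail≡fin⇒tr≈ f v-tail≡β))) v-tail≡β

      sp⊎<v-tail : ∀ f γ → sp v tr f γ ⊎ fin γ <∞ v (tail f γ)
      sp⊎<v-tail f γ with ≤∞⇒<∞⊎≡ (t1 f γ)
      ... | inj₁ γ<v-tail = inj₂ γ<v-tail
      ... | inj₂ γ≡v-tail = inj₁ (sym γ≡v-tail)

      tr-fixed⇒¬sp : ∀ {f} → tr f γ ≈ᴹ f → ¬ sp v tr f γ
      tr-fixed⇒¬sp {γ} {f} tr≈f sp-γ
        with trans (sym sp-γ) (0⇒v-∞ (tail f γ) (x≈y⇒x∙y⁻¹≈ε (≈ᴹ-sym tr≈f)))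
      ... | ()

      <v⇒¬sp : ∀ {f} → fin γ <∞ v f → ¬ sp v tr f γ
      <v⇒¬sp {γ} {f} γ<vf sp-γ = <∞⇒≢ γ<vf (sym (trans (sym (v-cong tail≈f)) sp-γ))
        where
        tail≈f : tail f γ ≈ᴹ f
        tail≈f = ≈ᴹ-trans (//-cong₂ ≈ᴹ-refl (t2 f γ (<∞⇒≤∞ γ<vf))) (x//ε≈x f)

      sp-tr-injective : ∀ {f} → sp v tr f β → sp v tr f γ →
                        tr f β ≈ᴹ tr f γ → β ≡ γ
      sp-tr-injective sp-β sp-γ tr≈tr =
        fin-injective (trans (sym sp-β) (trans (v-cong (//-cong₂ ≈ᴹ-refl tr≈tr)) sp-γ))

      sp-tr-< : ∀ f → γ < α → sp v tr (tr f α) γ ⇔ sp v tr f γ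
      sp-tr-< {γ} {α} f γ<α =
        subst (λ w → sp v tr (tr f α) γ ⇔ w ≡ fin γ) (v-cong tail-tr+tail≈tail)
              (v-+-strict (tail (tr f α) γ) (tail f α)
                          (<∞-≤∞-trans (fin<fin γ<α) (t1 f α)))
        where
        tail-tr+tail≈tail : tail (tr f α) γ +ᴹ tail f α ≈ᴹ tail f γ
        tail-tr+tail≈tail = begin
          (tr f α −ᴹ tr (tr f α) γ) +ᴹ tail f α
            ≈⟨ +ᴹ-congʳ (//-cong₂ ≈ᴹ-refl (tr-tr-≤ f (inj₁ γ<α))) ⟩
          (tr f α −ᴹ tr f γ) +ᴹ (f −ᴹ tr f α)
            ≈⟨ +ᴹ-comm _ _ ⟩
          (f −ᴹ tr f α) +ᴹ (tr f α −ᴹ tr f γ)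
            ≈⟨ [x-y]∙[y-z]≈x-z f (tr f α) (tr f γ) ⟩
          tail f γ
            ∎

      sp-tr : ∀ f α γ → sp v tr (tr f α) γ ⇔ (sp v tr f γ × γ < α)
      sp-tr f α γ with <⊎≥ γ α
      ... | inj₁ γ<α = mk⇔ (λ sp-γ → Equivalence.to (sp-tr-< f γ<α) sp-γ , γ<α)
                           (λ (sp-γ , _) → Equivalence.from (sp-tr-< f γ<α) sp-γ)
      ... | inj₂ α≤γ = mk⇔ (λ sp-γ → ⊥-elim (tr-fixed⇒¬sp (tr-tr-≥ f α≤γ) sp-γ))
                           (λ (_ , γ<α) → ⊥-elim (≤⇒≯ α≤γ γ<α))

      sp-+ᴹ : ∀ f h γ → sp v tr (f +ᴹ h) γ → sp v tr f γ ⊎ sp v tr h γ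
      sp-+ᴹ f h γ sp-γ with sp⊎<v-tail f γ | sp⊎<v-tail h γ
      ... | inj₁ sp-f | _         = inj₁ sp-f
      ... | inj₂ _    | inj₁ sp-h = inj₂ sp-h
      ... | inj₂ γ<vf | inj₂ γ<vh =
        ⊥-elim (<∞⇒≢ γ<v[f+h] (sym (trans (sym (v-cong (tail-+ᴹ f h γ))) sp-γ)))
        where
        γ<v[f+h] : fin γ <∞ v (tail f γ +ᴹ tail h γ)
        γ<v[f+h] = v-+-upward (fin γ <∞_) <∞-≤∞-trans (tail f γ) (tail h γ) γ<vf γ<vh

      sp-*ₗ : ∀ (a : Carrier) → ¬ a ≈ 0# → ∀ f γ →
              sp v tr (a *ₗ f) γ ⇔ sp v tr f γ
      sp-*ₗ a a≉0 f γ = mk⇔ (trans (sym v-tail-*ₗ)) (trans v-tail-*ₗ)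
        where
        v-tail-*ₗ : v (tail (a *ₗ f) γ) ≡ v (tail f γ)
        v-tail-*ₗ = trans (v-cong (tail-*ₗ a f γ)) (v-scale a (tail f γ) a≉0)

      tail-tail-≥ : ∀ f → α ≤ γ → tail (tail f α) γ ≈ᴹ tail f γ
      tail-tail-≥ {α} {γ} f α≤γ = begin
        tail f α −ᴹ tr (tail f α) γ
          ≈⟨ //-cong₂ ≈ᴹ-refl (tr-−ᴹ f (tr f α) γ) ⟩
        tail f α −ᴹ (tr f γ −ᴹ tr (tr f α) γ)
          ≈⟨ //-cong₂ ≈ᴹ-refl (//-cong₂ ≈ᴹ-refl (tr-tr-≥ f α≤γ)) ⟩
        (f −ᴹ tr f α) −ᴹ (tr f γ −ᴹ tr f α)
          ≈⟨ [x-y]-[z-y]≈x-z f (tr f α) (tr f γ) ⟩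
        tail f γ
          ∎

      sp-tail : ∀ f α γ → sp v tr (tail f α) γ ⇔ (sp v tr f γ × α ≤ γ)
      sp-tail f α γ with <⊎≥ γ α
      ... | inj₁ γ<α =
        mk⇔ (λ sp-γ → ⊥-elim (<v⇒¬sp (<∞-≤∞-trans (fin<fin γ<α) (t1 f α)) sp-γ))
            (λ (_ , α≤γ) → ⊥-elim (≤⇒≯ α≤γ γ<α))
      ... | inj₂ α≤γ =
        mk⇔ (λ sp-γ → trans (sym (v-cong (tail-tail-≥ f α≤γ))) sp-γ , α≤γ)
            (λ (sp-γ , _) → trans (v-cong (tail-tail-≥ f α≤γ)) sp-γ)

      tr-fixed⊎tr-at-sp : ∀ f α →
        tr f α ≈ᴹ f ⊎ Σ Γ (λ β → sp v tr f β × tr f α ≈ᴹ tr f β × α ≤ β)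
      tr-fixed⊎tr-at-sp f α with v (tail f α) in v-tail≡
      ... | ∞     = inj₁ (≈ᴹ-sym (x∙y⁻¹≈ε⇒x≈y f (tr f α) (v-∞⇒0 (tail f α) v-tail≡)))
      ... | fin β = inj₂ (β , sp-v-tail f α β v-tail≡
                            , ≈ᴹ-sym (v-tail≡fin⇒tr≈ f v-tail≡)
                            , v-tail≡fin⇒≤ f v-tail≡)

      tr-fixed⇒sp< : ∀ {f} → tr f α ≈ᴹ f → ∀ δ → sp v tr f δ → δ < α
      tr-fixed⇒sp< {α} {f} tr≈f δ sp-δ with <⊎≥ δ α
      ... | inj₁ δ<α = δ<α
      ... | inj₂ α≤δ = ⊥-elim (tr-fixed⇒¬sp (begin
        tr f δ           ≈⟨ tr-cong δ tr≈f ⟨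
        tr (tr f α) δ    ≈⟨ tr-tr-≥ f α≤δ ⟩
        tr f α           ≈⟨ tr≈f ⟩
        f                ∎) sp-δ)

      tr-above-sp : ∀ f α → (∀ δ → sp v tr f δ → δ < α) → tr f α ≈ᴹ f
      tr-above-sp f α sp<α with tr-fixed⊎tr-at-sp f α
      ... | inj₁ tr≈f                 = tr≈f
      ... | inj₂ (β , sp-β , _ , α≤β) = ⊥-elim (≤⇒≯ α≤β (sp<α β sp-β))

      tr-not-above-sp : ∀ f α → ¬ (∀ δ → sp v tr f δ → δ < α) →
                        Σ Γ (λ β → (sp v tr f β × tr f α ≈ᴹ tr f β)
                                   × (∀ β′ → sp v tr f β′ → tr f α ≈ᴹ tr f β′ → β′ ≡ β)
                                   × α ≤ β)
      tr-not-above-sp f α ¬sp<α with tr-fixed⊎tr-at-sp f α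
      ... | inj₁ tr≈f                      = ⊥-elim (¬sp<α (tr-fixed⇒sp< tr≈f))
      ... | inj₂ (β , sp-β , tr≈trβ , α≤β) = β , (sp-β , tr≈trβ) , unique , α≤β
        where
        unique : ∀ β′ → sp v tr f β′ → tr f α ≈ᴹ tr f β′ → β′ ≡ β
        unique β′ sp-β′ tr≈trβ′ =
          sp-tr-injective sp-β′ sp-β (≈ᴹ-trans (≈ᴹ-sym tr≈trβ′) tr≈trβ)

lemma2p2 : ∀ {c ℓ m ℓm g ℓg : Level}
  (C : CommutativeRing c ℓ) → IsField C →
  (E : Module C m ℓm) →
  (Γ : Set g) (_<_ : Rel Γ ℓg) (sto : IsStrictTotalOrder _≡_ _<_) →
  let open CommutativeRing C
      open Module E
      open Setup C E Γ _<_ sto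
  in (v : Carrierᴹ → Γ∞ Γ) → IsValuation v →
     (tr : Carrierᴹ → Γ → Carrierᴹ) → IsTruncation v tr →
     -- (i) sp(f|_α) = sp(f)^{<α}
     (∀ f α γ → sp v tr (tr f α) γ ⇔ (sp v tr f γ × γ < α))
     -- (ii) sp(f+g) ⊆ sp(f) ∪ sp(g), and sp(cf) = sp(f) for c ≠ 0
     × (∀ f h γ → sp v tr (f +ᴹ h) γ → sp v tr f γ ⊎ sp v tr h γ)
     × (∀ (a : Carrier) → ¬ (a ≈ 0#) → ∀ f γ → sp v tr (a *ₗ f) γ ⇔ sp v tr f γ)
     -- (iii) sp(f - f|_α) = sp(f)^{≥α}
     × (∀ f α γ → sp v tr (f −ᴹ tr f α) γ ⇔ (sp v tr f γ × α ≤ γ))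
     -- (iv) v(f - f|_α) = β ⇒ β ∈ sp(f)
     × (∀ f α β → v (f −ᴹ tr f α) ≡ fin β → sp v tr f β)
     -- (v) α > sp(f) ⇒ f|_α = f; otherwise f|_α = f|_β for a unique β ∈ sp(f), and α ≤ β
     × (∀ f α →
          ((∀ δ → sp v tr f δ → δ < α) → tr f α ≈ᴹ f)
          × (¬ (∀ δ → sp v tr f δ → δ < α) →
               Σ Γ (λ β → (sp v tr f β × tr f α ≈ᴹ tr f β)
                          × (∀ β′ → sp v tr f β′ → tr f α ≈ᴹ tr f β′ → β′ ≡ β)
                          × α ≤ β)))
lemma2p2 C isField E Γ _<_ sto v isV tr isT =
  sp-tr , sp-+ᴹ , sp-*ₗ , sp-tail , sp-v-tail , λ f α → tr-above-sp f α , tr-not-above-sp f α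
  where
  open ValuedSpace C E Γ _<_ sto
  open Valuation (IsField.0≉1 isField) v isV
  open Truncation tr isT
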